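{- Let $G$ be a Hamiltonian graph which is not a complete graph of odd order. Then $G$ has an IPD.
   Context: All graphs are finite and simple. A graph $G$ of order $n$ is Hamiltonian if it contains a cycle of order $n$. A subgraph $H$ of $G$ is induced if for all $u,v\in V(H)$, $uv\in E(H)$ iff $uv\in E(G)$. An induced path decomposition of $G$ is a set of pairwise vertex-disjoint paths covering all vertices of $G$, each of which is an induced subgraph of $G$. $G$ has an IPD if it has an induced path decomposition in which every path has order (number of vertices) at least $2$. -}

module Defs where

open import Data.Nat using (ℕ; suc; _*_; _≤_)
open import Data.Fin using (Fin; toℕ)
open import Data.Bool using (Bool; true; false)
open import Data.List using (List; []; _∷_; length; lookup; concat; allFin; _∷ʳ_)
open import Data.List.Relation.Unary.All using (All)
open import Data.List.Relation.Unary.Unique.Propositional using (Unique)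
open import Data.List.Relation.Unary.Linked using (Linked)
open import Data.List.Relation.Binary.Permutation.Propositional using (_↭_)
open import Data.Product using (Σ; ∃; _×_)
open import Data.Sum using (_⊎_)
open import Relation.Binary.PropositionalEquality using (_≡_; _≢_)
open import Relation.Nullary using (¬_)

record Graph (n : ℕ) : Set where
  field
    adj    : Fin n → Fin n → Bool
    sym    : ∀ u v → adj u v ≡ adj v u
    irrefl : ∀ v → adj v v ≡ false

open Graph public

module _ {n : ℕ} (G : Graph n) where

  Adj : Fin n → Fin n → Set
  Adj u v = adj G u v ≡ true

  Complete : Set
  Complete = ∀ u v → u ≢ v → Adj u v

  -- A cycle has at least 3 vertices.
  Hamiltonian : Set
  Hamiltonian = 3 ≤ n × Σ (Fin n) λ v → Σ (List (Fin n)) λ vs →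
    ((v ∷ vs) ↭ allFin n) × Linked Adj ((v ∷ vs) ∷ʳ v)

  IsInducedPath : List (Fin n) → Set
  IsInducedPath p = Unique p ×
    (∀ (i j : Fin (length p)) →
       (Adj (lookup p i) (lookup p j) → (toℕ i ≡ suc (toℕ j) ⊎ toℕ j ≡ suc (toℕ i)))
     × ((toℕ i ≡ suc (toℕ j) ⊎ toℕ j ≡ suc (toℕ i)) → Adj (lookup p i) (lookup p j)))

  IsInducedPathDecomposition : List (List (Fin n)) → Set
  IsInducedPathDecomposition ps = All IsInducedPath ps × (concat ps ↭ allFin n)

  HasIPD : Set
  HasIPD = Σ (List (List (Fin n))) λ ps →
    IsInducedPathDecomposition ps × All (λ p → 2 ≤ length p) ps

Odd : ℕ → Set
Odd n = ∃ λ k → n ≡ suc (2 * k)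

module Submission where

-- Walk along a Hamiltonian cycle v₀ v₁ … v_{n-1} (indices mod n).  For even n its edges
-- v₀v₁, v₂v₃, … form an IPD.  For odd n, if G is not complete then some chord length is
-- missing; let d ≥ 2 be the least length such that some v_i is not adjacent to v_{i+d}, and
-- rotate so that i = 0.  Then v₀ v₁ v_d is an induced path, since v₁v_d is a chord of length
-- d - 1 < d.  The other n - 3 vertices, taken in cyclic order, form a walk of even length
-- whose only step off the cycle, v_{d-1} v_{d+1}, is a chord of length 2 < d; cutting this
-- walk into consecutive pairs completes the decomposition.

open import Defs hiding (sym)
open import Data.Bool using (true) renaming (_≟_ to _≟ᵇ_)
open import Data.Fin using (Fin)
open import Data.Fin.Patterns using (0F; 1F; 2F)
open import Data.List using (List; []; _∷_; [_]; _++_; _∷ʳ_; length; concat; applyUpTo; allFin)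
open import Data.List.Properties using (++-assoc; length-++; length-applyUpTo; applyUpTo-∷ʳ; length-tabulate)
open import Data.List.Membership.Propositional.Properties using (∈-allFin)
open import Data.List.Relation.Unary.All as All using (All; []; _∷_)
open import Data.List.Relation.Unary.AllPairs using ([]; _∷_)
open import Data.List.Relation.Unary.Any using (here; there)
open import Data.List.Relation.Unary.Any.Properties using (applyUpTo⁻)
open import Data.List.Relation.Unary.Linked as Linked using (Linked; []; [-]; _∷_)
open import Data.List.Relation.Unary.Linked.Properties using (applyUpTo⁺₂)
open import Data.List.Relation.Unary.Unique.Propositional using (Unique)
open import Data.List.Relation.Unary.Unique.Propositional.Properties using (allFin⁺; Unique[x∷xs]⇒x∉xs)
open import Data.List.Relation.Binary.Permutation.Propositional
  using (_↭_; ↭-sym; ↭-trans; prep; ↭⇒↭ₛ; module PermutationReasoning)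
open import Data.List.Relation.Binary.Permutation.Propositional.Properties using (shift; ++-comm; ∈-resp-↭; ↭-length)
import Data.List.Relation.Binary.Permutation.Setoid.Properties as SetoidPermutation
open import Data.Nat using (ℕ; zero; suc; _+_; _*_; _<_; _≤_; z≤n; s≤s; _<?_; NonZero; _%_; _/_)
open import Data.Nat.DivMod using (m≡m%n+[m/n]*n; m%n<n)
open import Data.Nat.Properties
  using (+-assoc; +-comm; +-identityʳ; *-suc; suc-injective; 1+n≢n; m+1+n≢0; ≤-refl; <⇒≤; ≤-<-trans;
         m<1+n⇒m<n∨m≡n; m<n⇒m<1+n; m∸n≤m; m<n⇒0<n∸m; m∸n+n≡m; m≤n⇒∃[o]m+o≡n; <-cmp; allUpTo?;
         +-commutativeSemigroup)
open import Algebra.Properties.CommutativeSemigroup +-commutativeSemigroup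
  using () renaming (x∙yz≈y∙xz to m+[n+o]≡n+[m+o])
open import Data.Product using (∃; _×_; _,_; proj₁; proj₂)
open import Data.Sum using (_⊎_; inj₁; inj₂; [_,_]′)
open import Function using (_∘_; const)
open import Relation.Binary.Definitions using (tri<; tri≈; tri>)
open import Relation.Binary.PropositionalEquality
  using (_≡_; _≢_; refl; sym; trans; cong; cong₂; subst; subst₂; setoid)
open import Relation.Nullary using (¬_; Dec; yes; no; contradiction)
open import Relation.Nullary.Decidable using (_→-dec_)
open import Relation.Unary using (Decidable)

Even : ℕ → Set
Even n = ∃ λ k → n ≡ 2 * k

even-or-odd : ∀ n → Even n ⊎ Odd n
even-or-odd zero = inj₁ (0 , refl)
even-or-odd (suc n) with even-or-odd n
... | inj₁ (k , n≡2k)   = inj₂ (k , cong suc n≡2k)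
... | inj₂ (k , n≡1+2k) = inj₁ (suc k , trans (cong suc n≡1+2k) (sym (*-suc 2 k)))

¬even-1 : ¬ Even 1
¬even-1 (zero  , ())
¬even-1 (suc k , 1≡2+2k) = m+1+n≢0 k (sym (suc-injective 1≡2+2k))

even-suc-suc⁻ : ∀ {n} → Even (suc (suc n)) → Even n
even-suc-suc⁻ (zero  , ())
even-suc-suc⁻ (suc k , eq) = k , suc-injective (suc-injective (trans eq (*-suc 2 k)))

odd-suc⁻ : ∀ {n} → Odd (suc n) → Even n
odd-suc⁻ (k , eq) = k , suc-injective eq

least-counterexample : ∀ {P : ℕ → Set} → Decidable P → ∀ v → ¬ (∀ {k} → k < v → P k) →
                       ∃ λ k → k < v × ¬ P k × (∀ {j} → j < k → P j)
least-counterexample P? zero    ¬all = contradiction (λ ()) ¬all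
least-counterexample P? (suc v) ¬all with allUpTo? P? v
... | yes below = v , ≤-refl , (λ Pv → ¬all (λ k<1+v → [ below , (λ { refl → Pv }) ]′ (m<1+n⇒m<n∨m≡n k<1+v))) , below
... | no ¬below with least-counterexample P? v ¬below
...   | k , k<v , ¬Pk , shorter = k , m<n⇒m<1+n k<v , ¬Pk , shorter

module _ {A : Set} where

  applyUpTo-cong : ∀ {f g : ℕ → A} → (∀ k → f k ≡ g k) → ∀ m → applyUpTo f m ≡ applyUpTo g m
  applyUpTo-cong f≗g zero    = refl
  applyUpTo-cong f≗g (suc m) = cong₂ _∷_ (f≗g 0) (applyUpTo-cong (f≗g ∘ suc) m)

  applyUpTo-++ : ∀ (f : ℕ → A) m k → applyUpTo f (m + k) ≡ applyUpTo f m ++ applyUpTo (λ i → f (m + i)) k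
  applyUpTo-++ f zero    k = refl
  applyUpTo-++ f (suc m) k = cong (f 0 ∷_) (applyUpTo-++ (f ∘ suc) m k)

  Periodic : ℕ → (ℕ → A) → Set
  Periodic L f = ∀ k → f (L + k) ≡ f k

  periodic-*+ : ∀ {L f} → Periodic L f → ∀ q r → f (q * L + r) ≡ f r
  periodic-*+ periodic zero    r = refl
  periodic-*+ {L} {f} periodic (suc q) r =
    trans (cong f (+-assoc L (q * L) r)) (trans (periodic (q * L + r)) (periodic-*+ periodic q r))

  applyUpTo-rotate : ∀ {L f i} → Periodic L f → i ≤ L → applyUpTo (λ k → f (i + k)) L ↭ applyUpTo f L
  applyUpTo-rotate {f = f} {i} periodic i≤L with m≤n⇒∃[o]m+o≡n i≤L
  ... | o , refl = begin
    applyUpTo (λ k → f (i + k)) (i + o)        ≡⟨ cong (applyUpTo _) (+-comm i o) ⟩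
    applyUpTo (λ k → f (i + k)) (o + i)        ≡⟨ applyUpTo-++ _ o i ⟩
    applyUpTo (λ k → f (i + k)) o ++ wrapped   ≡⟨ cong (applyUpTo (λ k → f (i + k)) o ++_) (applyUpTo-cong wrap i) ⟩
    applyUpTo (λ k → f (i + k)) o ++ applyUpTo f i
                                               ↭⟨ ++-comm _ (applyUpTo f i) ⟩
    applyUpTo f i ++ applyUpTo (λ k → f (i + k)) o
                                               ≡⟨ applyUpTo-++ f i o ⟨
    applyUpTo f (i + o)                        ∎
    where
    open PermutationReasoning
    wrapped : List A
    wrapped = applyUpTo (λ k → f (i + (o + k))) i
    wrap : ∀ k → f (i + (o + k)) ≡ f k
    wrap k = trans (cong f (sym (+-assoc i o k))) (periodic k)

  skipping : (ℕ → A) → ℕ → ℕ → List A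
  skipping f m k = applyUpTo f m ++ applyUpTo (λ i → f (suc m + i)) k

  applyUpTo-skipping : ∀ f m k → applyUpTo f (suc m + k) ↭ f m ∷ skipping f m k
  applyUpTo-skipping f m k = begin
    applyUpTo f (suc m + k)             ≡⟨ applyUpTo-++ f (suc m) k ⟩
    applyUpTo f (suc m) ++ rest         ≡⟨ cong (_++ rest) (applyUpTo-∷ʳ f m) ⟨
    (applyUpTo f m ∷ʳ f m) ++ rest      ≡⟨ ++-assoc (applyUpTo f m) [ f m ] rest ⟩
    applyUpTo f m ++ f m ∷ rest         ↭⟨ shift (f m) (applyUpTo f m) rest ⟩
    f m ∷ skipping f m k                ∎
    where
    open PermutationReasoning
    rest : List A
    rest = applyUpTo (λ i → f (suc m + i)) k

  length-skipping : ∀ f m k → length (skipping f m k) ≡ m + k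
  length-skipping f m k =
    trans (length-++ (applyUpTo f m)) (cong₂ _+_ (length-applyUpTo f m) (length-applyUpTo _ k))

  skipping-Linked : ∀ {R : A → A → Set} {f m k} → (∀ i → R (f i) (f (suc i))) →
                    (∀ {e} → m ≡ suc e → R (f e) (f (suc m))) → Linked R (skipping f m k)
  skipping-Linked {m = zero}                  step jump = applyUpTo⁺₂ _ _ (step ∘ suc)
  skipping-Linked {m = suc zero} {k = zero}   step jump = [-]
  skipping-Linked {m = suc zero} {k = suc k}  step jump = jump refl ∷ applyUpTo⁺₂ _ (suc k) (step ∘ suc ∘ suc)
  skipping-Linked {m = suc (suc m)}           step jump = step 0 ∷ skipping-Linked (step ∘ suc) (jump ∘ cong suc)

  pairs : List A → List (List A)
  pairs []           = []
  pairs (x ∷ [])     = [ x ∷ [] ]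
  pairs (x ∷ y ∷ xs) = (x ∷ y ∷ []) ∷ pairs xs

  concat-pairs : ∀ xs → concat (pairs xs) ≡ xs
  concat-pairs []           = refl
  concat-pairs (x ∷ [])     = refl
  concat-pairs (x ∷ y ∷ xs) = cong (λ ys → x ∷ y ∷ ys) (concat-pairs xs)

module Cyclic {A : Set} (x : A) (xs : List A) where

  -- cyclicFrom ys k is the k-th entry of ys followed by x ∷ xs repeated forever.
  cyclicFrom : List A → ℕ → A
  cyclicFrom []       zero    = x
  cyclicFrom []       (suc k) = cyclicFrom xs k
  cyclicFrom (y ∷ ys) zero    = y
  cyclicFrom (y ∷ ys) (suc k) = cyclicFrom ys k

  cyclic : ℕ → A
  cyclic = cyclicFrom (x ∷ xs)

  cyclicFrom-[] : ∀ k → cyclicFrom [] k ≡ cyclic k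
  cyclicFrom-[] zero    = refl
  cyclicFrom-[] (suc k) = refl

  cyclicFrom-length+ : ∀ ys k → cyclicFrom ys (length ys + k) ≡ cyclicFrom [] k
  cyclicFrom-length+ []       k = refl
  cyclicFrom-length+ (y ∷ ys) k = cyclicFrom-length+ ys k

  cyclic-periodic : Periodic (length (x ∷ xs)) cyclic
  cyclic-periodic k = trans (cyclicFrom-length+ (x ∷ xs) k) (cyclicFrom-[] k)

  applyUpTo-cyclicFrom : ∀ ys → applyUpTo (cyclicFrom ys) (length ys) ≡ ys
  applyUpTo-cyclicFrom []       = refl
  applyUpTo-cyclicFrom (y ∷ ys) = cong (y ∷_) (applyUpTo-cyclicFrom ys)

  module _ {R : A → A → Set} (closed : Linked R ((x ∷ xs) ∷ʳ x)) where

    cyclicFrom-head : ∀ {y ys} → Linked R ((y ∷ ys) ∷ʳ x) → R y (cyclicFrom ys 0)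
    cyclicFrom-head {ys = []}    link = Linked.head link
    cyclicFrom-head {ys = _ ∷ _} link = Linked.head link

    cyclicFrom-step : ∀ ys → Linked R (ys ∷ʳ x) → ∀ k → R (cyclicFrom ys k) (cyclicFrom ys (suc k))
    cyclicFrom-step []       _    zero    = cyclicFrom-head closed
    cyclicFrom-step []       _    (suc k) = cyclicFrom-step xs (Linked.tail closed) k
    cyclicFrom-step (y ∷ ys) link zero    = cyclicFrom-head link
    cyclicFrom-step (y ∷ ys) link (suc k) = cyclicFrom-step ys (Linked.tail link) k

    cyclic-step : ∀ k → R (cyclic k) (cyclic (suc k))
    cyclic-step = cyclicFrom-step (x ∷ xs) closed

module _ {n : ℕ} (G : Graph n) where

  adj? : ∀ u w → Dec (Adj G u w)
  adj? u w = adj G u w ≟ᵇ true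

  Adj-sym : ∀ {u w} → Adj G u w → Adj G w u
  Adj-sym {u} {w} uw = trans (Graph.sym G w u) uw

  Adj-irrefl : ∀ {u} → ¬ Adj G u u
  Adj-irrefl {u} uu with trans (sym uu) (irrefl G u)
  ... | ()

  Adj⇒≢ : ∀ {u w} → Adj G u w → u ≢ w
  Adj⇒≢ uw refl = Adj-irrefl uw

  private
    Consecutive : ℕ → ℕ → Set
    Consecutive i j = i ≡ suc j ⊎ j ≡ suc i

    adjacent : ∀ {u w i j} → Adj G u w → Consecutive i j →
               (Adj G u w → Consecutive i j) × (Consecutive i j → Adj G u w)
    adjacent uw ij = const ij , const uw

    apart : ∀ {u w i j} → ¬ Adj G u w → ¬ Consecutive i j →
            (Adj G u w → Consecutive i j) × (Consecutive i j → Adj G u w)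
    apart ¬uw ¬ij = (λ uw → contradiction uw ¬uw) , (λ ij → contradiction ij ¬ij)

    diagonal : ∀ {u} i → (Adj G u u → Consecutive i i) × (Consecutive i i → Adj G u u)
    diagonal i = apart Adj-irrefl [ 1+n≢n ∘ sym , 1+n≢n ∘ sym ]′

  edge-IsInducedPath : ∀ {x y} → Adj G x y → IsInducedPath G (x ∷ y ∷ [])
  edge-IsInducedPath xy = ((Adj⇒≢ xy ∷ []) ∷ [] ∷ []) , λ
    { 0F 0F → diagonal 0
    ; 0F 1F → adjacent xy (inj₂ refl)
    ; 1F 0F → adjacent (Adj-sym xy) (inj₁ refl)
    ; 1F 1F → diagonal 1
    }

  P₃-IsInducedPath : ∀ {x y z} → Adj G x y → Adj G y z → ¬ Adj G x z → x ≢ z →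
                     IsInducedPath G (x ∷ y ∷ z ∷ [])
  P₃-IsInducedPath xy yz ¬xz x≢z = ((Adj⇒≢ xy ∷ x≢z ∷ []) ∷ (Adj⇒≢ yz ∷ []) ∷ [] ∷ []) , λ
    { 0F 0F → diagonal 0
    ; 0F 1F → adjacent xy (inj₂ refl)
    ; 0F 2F → apart ¬xz λ { (inj₁ ()) ; (inj₂ ()) }
    ; 1F 0F → adjacent (Adj-sym xy) (inj₁ refl)
    ; 1F 1F → diagonal 1
    ; 1F 2F → adjacent yz (inj₂ refl)
    ; 2F 0F → apart (¬xz ∘ Adj-sym) λ { (inj₁ ()) ; (inj₂ ()) }
    ; 2F 1F → adjacent (Adj-sym yz) (inj₁ refl)
    ; 2F 2F → diagonal 2
    }

  LongInducedPath : List (Fin n) → Set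
  LongInducedPath p = IsInducedPath G p × 2 ≤ length p

  pairs-LongInducedPath : ∀ {xs} → Linked (Adj G) xs → Even (length xs) → All LongInducedPath (pairs xs)
  pairs-LongInducedPath []               _    = []
  pairs-LongInducedPath [-]              even = contradiction even ¬even-1
  pairs-LongInducedPath (xy ∷ [-])       _    = (edge-IsInducedPath xy , s≤s (s≤s z≤n)) ∷ []
  pairs-LongInducedPath (xy ∷ _ ∷ links) even =
    (edge-IsInducedPath xy , s≤s (s≤s z≤n)) ∷ pairs-LongInducedPath links (even-suc-suc⁻ even)

  hasIPD : ∀ ps → concat ps ↭ allFin n → All LongInducedPath ps → HasIPD G
  hasIPD ps cover long = ps , (All.map proj₁ long , cover) , All.map proj₂ long

  Chord : (ℕ → Fin n) → ℕ → Set
  Chord f k = ∀ j → Adj G (f j) (f (k + j))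

  even-IPD : ∀ f L → Chord f 1 → applyUpTo f L ↭ allFin n → Even L → HasIPD G
  even-IPD f L step cover even = hasIPD (pairs walk) (subst (_↭ allFin n) (sym (concat-pairs walk)) cover)
    (pairs-LongInducedPath (applyUpTo⁺₂ f L step) (subst Even (sym (length-applyUpTo f L)) even))
    where
    walk : List (Fin n)
    walk = applyUpTo f L

  Chord-shift : ∀ {f k} i → Chord f k → Chord (λ j → f (i + j)) k
  Chord-shift {f} {k} i chord j = subst (λ c → Adj G (f (i + j)) (f c)) (m+[n+o]≡n+[m+o] k i j) (chord (i + j))

  missing-chord-IPD : ∀ (h : ℕ → Fin n) e b → applyUpTo h (3 + e + b) ↭ allFin n → Even (e + b) →
               (∀ {k} → 0 < k → k < 2 + e → Chord h k) → ¬ Adj G (h 0) (h (2 + e)) → HasIPD G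
  missing-chord-IPD h e b cover even shorter ¬adj =
    hasIPD ((h 0 ∷ h 1 ∷ g e ∷ []) ∷ pairs rest) cover′ ((P₃ , s≤s (s≤s z≤n)) ∷ pairs-LongInducedPath linked even′)
    where
    g : ℕ → Fin n
    g k = h (2 + k)
    rest : List (Fin n)
    rest = skipping g e b
    step : Chord h 1
    step = shorter (s≤s z≤n) (s≤s (s≤s z≤n))
    cover′ : h 0 ∷ h 1 ∷ g e ∷ concat (pairs rest) ↭ allFin n
    cover′ = begin
      h 0 ∷ h 1 ∷ g e ∷ concat (pairs rest) ≡⟨ cong (λ r → h 0 ∷ h 1 ∷ g e ∷ r) (concat-pairs rest) ⟩
      h 0 ∷ h 1 ∷ g e ∷ rest                ↭⟨ prep (h 0) (prep (h 1) (↭-sym (applyUpTo-skipping g e b))) ⟩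
      applyUpTo h (3 + e + b)               ↭⟨ cover ⟩
      allFin n                              ∎
      where open PermutationReasoning
    distinct : h 0 ≢ g e
    distinct eq = Unique[x∷xs]⇒x∉xs
      (SetoidPermutation.Unique-resp-↭ (setoid (Fin n)) (↭⇒↭ₛ (↭-sym cover′)) (allFin⁺ n)) (there (here eq))
    P₃ : IsInducedPath G (h 0 ∷ h 1 ∷ g e ∷ [])
    P₃ = P₃-IsInducedPath (step 0) (subst (λ k → Adj G (h 1) (h k)) (+-comm (suc e) 1) (shorter (s≤s z≤n) ≤-refl 1))
                          ¬adj distinct
    jump : ∀ {e′} → e ≡ suc e′ → Adj G (g e′) (g (suc e))
    jump {e′} refl = shorter (s≤s z≤n) (s≤s (s≤s (s≤s z≤n))) (2 + e′)
    linked : Linked (Adj G) rest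
    linked = skipping-Linked (step ∘ suc ∘ suc) jump
    even′ : Even (length rest)
    even′ = subst Even (sym (length-skipping g e b)) even

  module _ (f : ℕ → Fin n) (L : ℕ) .{{_ : NonZero L}}
           (periodic : Periodic L f) (cover : applyUpTo f L ↭ allFin n) where

    ChordBelow : ℕ → Set
    ChordBelow k = ∀ {j} → j < L → Adj G (f j) (f (k + j))

    chordBelow? : ∀ k → Dec (ChordBelow k)
    chordBelow? k = allUpTo? (λ j → adj? (f j) (f (k + j))) L

    located : ∀ u → ∃ λ a → a < L × u ≡ f a
    located u = applyUpTo⁻ f (∈-resp-↭ (↭-sym cover) (∈-allFin u))

    chordBelow⇒Chord : ∀ {k} → ChordBelow k → Chord f k
    chordBelow⇒Chord {k} below j = subst₂ (Adj G) (sym (trans (cong f j≡) (reduce r)))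
      (trans (sym (reduce (k + r))) (cong f shifted)) (below (m%n<n j L))
      where
      r q : ℕ
      r = j % L
      q = j / L
      reduce : ∀ i → f (q * L + i) ≡ f i
      reduce = periodic-*+ periodic q
      j≡ : j ≡ q * L + r
      j≡ = trans (m≡m%n+[m/n]*n j L) (+-comm r (q * L))
      shifted : q * L + (k + r) ≡ k + j
      shifted = trans (m+[n+o]≡n+[m+o] (q * L) k r) (cong (k +_) (sym j≡))

    AllChordsBelow : Set
    AllChordsBelow = ∀ {k} → k < L → 0 < k → ChordBelow k

    allChordsBelow⇒Adj : AllChordsBelow → ∀ {a b} → a < b → b < L → Adj G (f a) (f b)
    allChordsBelow⇒Adj chords {a} {b} a<b b<L = subst (λ c → Adj G (f a) (f c)) (m∸n+n≡m (<⇒≤ a<b))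
      (chords (≤-<-trans (m∸n≤m b a) b<L) (m<n⇒0<n∸m a<b) (≤-<-trans (<⇒≤ a<b) b<L))

    allChordsBelow⇒Complete : AllChordsBelow → Complete G
    allChordsBelow⇒Complete chords u w u≢w with located u | located w
    ... | a , a<L , refl | b , b<L , refl with <-cmp a b
    ... | tri< a<b _ _  = allChordsBelow⇒Adj chords a<b b<L
    ... | tri≈ _ refl _ = contradiction refl u≢w
    ... | tri> _ _ b<a  = Adj-sym (allChordsBelow⇒Adj chords b<a a<L)

    shortest-missing-chord : ¬ Complete G → Chord f 1 →
      ∃ λ e → 2 + e < L × ¬ ChordBelow (2 + e) × (∀ {k} → 0 < k → k < 2 + e → Chord f k)
    shortest-missing-chord incomplete step
      with least-counterexample (λ k → 0 <? k →-dec chordBelow? k) L (incomplete ∘ allChordsBelow⇒Complete)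
    ... | zero        , _   , missing , _       = contradiction (λ ()) missing
    ... | suc zero    , _   , missing , _       = contradiction (λ _ {j} _ → step j) missing
    ... | suc (suc e) , d<L , missing , shorter =
      e , d<L , (λ below → missing (const below)) , (λ 0<k k<d → chordBelow⇒Chord (shorter k<d 0<k))

    odd-IPD : Chord f 1 → Odd L → ¬ Complete G → HasIPD G
    odd-IPD step odd incomplete with shortest-missing-chord incomplete step
    ... | e , d<L , missing , shorter
      with least-counterexample (λ j → adj? (f j) (f (2 + e + j))) L missing | m≤n⇒∃[o]m+o≡n d<L
    ... | i , i<L , ¬adj , _ | b , 3+e+b≡L =
      missing-chord-IPD h e b coverₕ (even-suc-suc⁻ (odd-suc⁻ (subst Odd (sym 3+e+b≡L) odd)))
        (λ 0<k k<d → Chord-shift i (shorter 0<k k<d)) (¬adj ∘ subst₂ (Adj G) (cong f (+-identityʳ i)) (cong f (+-comm i (2 + e))))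
      where
      h : ℕ → Fin n
      h k = f (i + k)
      coverₕ : applyUpTo h (3 + e + b) ↭ allFin n
      coverₕ = subst (λ m → applyUpTo h m ↭ allFin n) (sym 3+e+b≡L)
        (↭-trans (applyUpTo-rotate periodic (<⇒≤ i<L)) cover)

theorem4 : (n : ℕ) (G : Graph n) → Hamiltonian G → ¬ (Complete G × Odd n) → HasIPD G
theorem4 n G (_ , v , vs , cycle , closed) ¬complete-odd =
  [ (λ even → even-IPD G f L step cover (subst Even (sym L≡n) even))
  , (λ odd → odd-IPD G f L cyclic-periodic cover step (subst Odd (sym L≡n) odd) (λ complete → ¬complete-odd (complete , odd)))
  ]′ (even-or-odd n)
  where
  open Cyclic v vs
  f : ℕ → Fin n
  f = cyclic
  L : ℕ
  L = length (v ∷ vs)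
  step : Chord G f 1
  step = cyclic-step closed
  cover : applyUpTo f L ↭ allFin n
  cover = subst (_↭ allFin n) (sym (applyUpTo-cyclicFrom (v ∷ vs))) cycle
  L≡n : L ≡ n
  L≡n = trans (↭-length cycle) (length-tabulate (λ i → i))
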